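{- Let $\mathbf{y}=g(f^\omega(0))$. For every $n\ge 2$, $\mathbf{y}$ has exactly two right-special factors $u$ and $v$ of length $n$, where $u$ ends with $02$ and $u1,u2$ are factors of $\mathbf{y}$, and $v$ ends with $22$ and $v0,v2$ are factors of $\mathbf{y}$.
   Context: $f(0)=01$, $f(1)=022$, $f(2)=02$; $g(0)=20$, $g(1)=21$, $g(2)=2$ on $\Sigma_3=\{0,1,2\}$; $f^\omega(0)$ is the fixed point of $f$ beginning with $0$. A factor $w$ of an infinite word $\mathbf{u}$ is right-special if there are at least two distinct letters $a$ such that $wa$ is a factor of $\mathbf{u}$. -}

module Defs where

open import Data.Nat using (ℕ; zero; suc)
open import Data.List using (List; []; _∷_; _++_; concatMap; length)
open import Data.Product using (∃-syntax; _×_)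
open import Relation.Binary.PropositionalEquality using (_≡_; _≢_)

data Σ₃ : Set where
  c0 c1 c2 : Σ₃

Word : Set
Word = List Σ₃

InfWord : Set
InfWord = ℕ → Σ₃

f : Σ₃ → Word
f c0 = c0 ∷ c1 ∷ []
f c1 = c0 ∷ c2 ∷ c2 ∷ []
f c2 = c0 ∷ c2 ∷ []

g : Σ₃ → Word
g c0 = c2 ∷ c0 ∷ []
g c1 = c2 ∷ c1 ∷ []
g c2 = c2 ∷ []

morph : (Σ₃ → Word) → Word → Word
morph h w = concatMap h w

iter : ℕ → (Σ₃ → Word) → Word → Word
iter zero    h w = w
iter (suc k) h w = morph h (iter k h w)

nth : Word → ℕ → Σ₃ → Σ₃
nth []      _       d = d
nth (a ∷ _) zero    d = a
nth (_ ∷ w) (suc i) d = nth w i d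

prefix : InfWord → ℕ → Word
prefix x zero    = []
prefix x (suc n) = x zero ∷ prefix (λ i → x (suc i)) n

-- f^ω(0): the limit of the words f^k(0); since |f^k(0)| ≥ k+1 (every
-- image under f has length ≥ 2), the i-th letter is that of f^(i+1)(0).
fω0 : InfWord
fω0 i = nth (iter (suc i) f (c0 ∷ [])) i c0

-- image of an infinite word under the non-erasing morphism g:
-- g(x[0..i]) has length ≥ i+1, so its i-th letter is the i-th letter of g(x).
morphInf : (Σ₃ → Word) → InfWord → InfWord
morphInf h x i = nth (morph h (prefix x (suc i))) i c0

y : InfWord
y = morphInf g fω0

slice : InfWord → ℕ → ℕ → Word
slice x i n = prefix (λ j → x (i Data.Nat.+ j)) n
  where import Data.Nat

Factor : InfWord → Word → Set
Factor x w = ∃[ i ] slice x i (length w) ≡ w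

RightSpecial : InfWord → Word → Set
RightSpecial x w = ∃[ a ] ∃[ b ] (a ≢ b × Factor x (w ++ a ∷ []) × Factor x (w ++ b ∷ []))

EndsWith : Word → Word → Set
EndsWith w s = ∃[ p ] w ≡ p ++ s

-- Both f and g are codes whose images begin with a marker letter (0 for f, 2 for g) that
-- occurs nowhere else in an image, so every occurrence of a factor in f(x) or g(x) can be
-- desubstituted block by block.
--
-- In x = f^ω(0), suppose E z and E′ z are both right special with E ≠ E′ and z nonempty.
-- Looking at the last letter of z and at the two right extensions, and desubstituting
-- through f, produces a strictly shorter nonempty word with the same property, which is
-- impossible by infinite descent. Hence a right special factor of x is determined by its
-- length and its last letter (never 1), so it is a suffix of α k or β k, where
-- α 0 = 0, β 0 = 2, α (k+1) = f(β k) 0, β (k+1) = f(α k) 02.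
--
-- A right special factor of y = g(x) of length at least 2 ends with 2, and desubstituting
-- it through g yields a right special factor z of x; so it is a suffix of g(z) 2, hence of
-- g(α K) 2 or g(β K) 2. Both families increase for the suffix order, so for each length n
-- there is one candidate in each family: the suffixes of length n of g(α n) 2 and g(β n) 2.

module Submission where

open import Defs
open import Data.Nat using (ℕ; _≤_)
open import Data.List using (List; []; _∷_; _++_; length)
open import Data.Product using (∃-syntax; _×_)
open import Data.Sum using (_⊎_)
open import Relation.Binary.PropositionalEquality using (_≡_)

open import Data.Empty using (⊥; ⊥-elim)
open import Data.Unit using (⊤; tt)
open import Data.Nat using (zero; suc; _+_; _∸_; _<_; z≤n; s≤s)
open import Data.Nat.Properties
  using (+-comm; ≤-refl; ≤-trans; ≤-reflexive; <⇒≤; n≤1+n; m≤m+n; +-monoʳ-<; ≤-total; suc-injective; 1+n≰n;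
         m∸n+n≡m; m∸[m∸n]≡n)
open import Data.Nat.Induction using (<-wellFounded)
open import Data.List using (concatMap; [_]; take; drop)
open import Data.List.Properties
  using (++-assoc; ++-identityʳ; ++-conicalʳ; ++-monoid; ∷-injective; ∷ʳ-++; ≡-dec; concatMap-++;
         length-++-≤ˡ; length-++-≤ʳ; length-drop; take-all; take++drop≡id)
open import Data.List.Relation.Unary.All using (All; []; _∷_)
open import Data.List.Relation.Unary.All.Properties using (++⁻ʳ)
open import Data.List.Reverse using (reverseView; []; _∶_∶ʳ_)
open import Data.Product using (_,_; proj₁; proj₂; map₂)
open import Data.Sum using (inj₁; inj₂)
import Data.Sum as Sum
import Induction.WellFounded as WF
open import Relation.Binary.Definitions using (DecidableEquality)
import Relation.Binary.Construct.On as On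
open import Relation.Binary.PropositionalEquality
  using (refl; sym; trans; cong; cong₂; subst; _≢_; module ≡-Reasoning)
open import Relation.Nullary using (¬_; yes; no)
open import Tactic.MonoidSolver using (solve)

_≟₃_ : DecidableEquality Σ₃
c0 ≟₃ c0 = yes refl
c0 ≟₃ c1 = no λ ()
c0 ≟₃ c2 = no λ ()
c1 ≟₃ c0 = no λ ()
c1 ≟₃ c1 = yes refl
c1 ≟₃ c2 = no λ ()
c2 ≟₃ c0 = no λ ()
c2 ≟₃ c1 = no λ ()
c2 ≟₃ c2 = yes refl

Infix : Word → Word → Set
Infix w L = ∃[ P ] ∃[ Q ] (L ≡ P ++ w ++ Q)

StartsWith : Word → Word → Set
StartsWith w s = ∃[ Q ] (w ≡ s ++ Q)

infix-trans : ∀ {u v w} → Infix u v → Infix v w → Infix u w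
infix-trans {u} (P₁ , Q₁ , refl) (P₂ , Q₂ , refl) =
  P₂ ++ P₁ , Q₁ ++ Q₂ , solve (++-monoid Σ₃)

Infix-morph : ∀ h {w L} → Infix w L → Infix (morph h w) (morph h L)
Infix-morph h {w} (P , Q , refl) =
  morph h P , morph h Q , trans (concatMap-++ h P (w ++ Q)) (cong (morph h P ++_) (concatMap-++ h w Q))

suffix⇒infix : ∀ {u w} → EndsWith w u → Infix u w
suffix⇒infix {u} (P , refl) = P , [] , cong (P ++_) (sym (++-identityʳ u))

++-regroup : ∀ (A B C D : Word) → A ++ (B ++ C) ++ D ≡ (A ++ B) ++ C ++ D
++-regroup A B C D = solve (++-monoid Σ₃)

++-split : ∀ (A B C D : Word) → A ++ B ≡ C ++ D →
           (∃[ M ] (C ≡ A ++ M × B ≡ M ++ D)) ⊎ (∃[ M ] (A ≡ C ++ M × D ≡ M ++ B))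
++-split []      B C       D eq = inj₁ (C , refl , eq)
++-split (a ∷ A) B []      D eq = inj₂ (a ∷ A , refl , sym eq)
++-split (a ∷ A) B (c ∷ C) D eq with ∷-injective eq
... | refl , eq′ with ++-split A B C D eq′
... | inj₁ (M , e₁ , e₂) = inj₁ (M , cong (a ∷_) e₁ , e₂)
... | inj₂ (M , e₁ , e₂) = inj₂ (M , cong (a ∷_) e₁ , e₂)

suffix-trans : ∀ {u v w} → EndsWith v u → EndsWith w v → EndsWith w u
suffix-trans {u} (P , refl) (Q , refl) = Q ++ P , sym (++-assoc Q P u)

suffix-++ : ∀ {u v} t → EndsWith v u → EndsWith (v ++ t) (u ++ t)
suffix-++ {u} t (P , refl) = P , ++-assoc P u t

EndsWith-morph : ∀ h {u v} → EndsWith v u → EndsWith (morph h v) (morph h u)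
EndsWith-morph h {u} (P , refl) = morph h P , concatMap-++ h P u

suffix-of-suffix : ∀ {L u v} → EndsWith L u → EndsWith L v → length u ≤ length v → EndsWith v u
suffix-of-suffix {_} {u} {v} (P , refl) (Q , eq) |u|≤|v| with ++-split P u Q v eq
... | inj₂ (M , _ , v≡)      = M , v≡
... | inj₁ ([] , _ , u≡v)    = [] , sym u≡v
... | inj₁ (c ∷ M , _ , refl) = ⊥-elim (1+n≰n (≤-trans (s≤s (length-++-≤ʳ v {M})) |u|≤|v|))

suffix-unique : ∀ {w u v} → EndsWith w u → EndsWith w v → length u ≡ length v → u ≡ v
suffix-unique u-suf v-suf |u|≡|v| with suffix-of-suffix u-suf v-suf (≤-reflexive |u|≡|v|)
... | []    , v≡u  = sym v≡u
... | c ∷ P , refl = ⊥-elim (1+n≰n (≤-trans (s≤s (length-++-≤ʳ _ {P})) (≤-reflexive (sym |u|≡|v|))))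

suffix-of-length : ∀ L n → n ≤ length L → ∃[ t ] (EndsWith L t × length t ≡ n)
suffix-of-length L n n≤|L| =
  drop (length L ∸ n) L , (take (length L ∸ n) L , sym (take++drop≡id (length L ∸ n) L)) ,
  trans (length-drop (length L ∸ n) L) (m∸[m∸n]≡n n≤|L|)

suffix-of-[] : ∀ {u} → EndsWith [] u → u ≡ []
suffix-of-[] {u} (P , eq) = ++-conicalʳ P u (sym eq)

suffix-chain : ∀ (W : ℕ → Word) → (∀ k → EndsWith (W (suc k)) (W k)) → ∀ j k → EndsWith (W (j + k)) (W k)
suffix-chain W next zero    k = [] , refl
suffix-chain W next (suc j) k = suffix-trans (suffix-chain W next j k) (next (j + k))

suffix-of-chain-unique : ∀ (W : ℕ → Word) → (∀ k → EndsWith (W (suc k)) (W k)) →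
                         ∀ {n w u} → ∃[ K ] EndsWith (W K) w → EndsWith (W n) u → length w ≡ length u → w ≡ u
suffix-of-chain-unique W next {n} (K , w-suf) u-suf |w|≡|u| =
  suffix-unique (suffix-trans w-suf (subst (λ m → EndsWith (W m) (W K)) (+-comm n K) (suffix-chain W next n K)))
                (suffix-trans u-suf (suffix-chain W next K n)) |w|≡|u|

[]≢++∷ : ∀ (X : Word) {a R} → [] ≢ X ++ a ∷ R
[]≢++∷ []      ()
[]≢++∷ (x ∷ X) ()

length-++-∷ : ∀ (w : Word) c v → length w < length (w ++ c ∷ v)
length-++-∷ []      c v = s≤s z≤n
length-++-∷ (a ∷ w) c v = s≤s (length-++-∷ w c v)

length-∷ʳ : ∀ (w : Word) c → length (w ++ [ c ]) ≡ suc (length w)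
length-∷ʳ []      c = refl
length-∷ʳ (a ∷ w) c = cong suc (length-∷ʳ w c)

init-nonempty : ∀ (w₀ : Word) {l} → 2 ≤ length (w₀ ++ [ l ]) → w₀ ≢ []
init-nonempty [] (s≤s ()) refl

-- Codes with a marker letter

MarkerFree : Σ₃ → Word → Set
MarkerFree m = All (_≢ m)

BeginsWithMarker : Σ₃ → Word → Set
BeginsWithMarker m T = T ≡ [] ⊎ StartsWith T [ m ]

-- A morphism h with h e = m ∷ body e and no m inside any body: in h(U) the marker m occurs
-- exactly at the block boundaries.
module MarkerCode (h : Σ₃ → Word) (m : Σ₃) (body : Σ₃ → Word)
                  (h≡m∷body : ∀ e → h e ≡ m ∷ body e)
                  (body-markerFree : ∀ e → MarkerFree m (body e))
                  (body-injective : ∀ {e e′} → body e ≡ body e′ → e ≡ e′) where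

  H : Word → Word
  H = morph h

  H-++ : ∀ U V → H (U ++ V) ≡ H U ++ H V
  H-++ = concatMap-++ h

  h-++ : ∀ e X → h e ++ X ≡ m ∷ body e ++ X
  h-++ e X = cong (_++ X) (h≡m∷body e)

  H-∷ʳ : ∀ U e → H (U ++ [ e ]) ≡ H U ++ h e
  H-∷ʳ U e = trans (H-++ U [ e ]) (cong (H U ++_) (++-identityʳ (h e)))

  length-H : ∀ U → length U ≤ length (H U)
  length-H []      = z≤n
  length-H (u ∷ U) = subst (λ w → suc (length U) ≤ length (w ++ H U)) (sym (h≡m∷body u))
                           (s≤s (≤-trans (length-H U) (length-++-≤ʳ (H U) {body u})))

  H-beginsWithMarker : ∀ U → BeginsWithMarker m (H U)
  H-beginsWithMarker []      = inj₁ refl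
  H-beginsWithMarker (u ∷ U) = inj₂ (body u ++ H U , h-++ u (H U))

  block-suffix : ∀ e X M → h e ≡ X ++ M → (X ≡ [] × M ≡ h e) ⊎ MarkerFree m M
  block-suffix e []      M eq = inj₁ (refl , sym eq)
  block-suffix e (x ∷ X) M eq =
    inj₂ (++⁻ʳ X (subst (MarkerFree m) (proj₂ (∷-injective (trans (sym (h≡m∷body e)) eq)))
                                       (body-markerFree e)))

  marker-starts-block : ∀ e X M → h e ≡ X ++ m ∷ M → X ≡ []
  marker-starts-block e X M eq with block-suffix e X (m ∷ M) eq
  ... | inj₁ (X≡[] , _) = X≡[]
  ... | inj₂ (m≢m ∷ _)  = ⊥-elim (m≢m refl)

  markerFree-prefix : ∀ t t′ T Q → MarkerFree m t → MarkerFree m t′ → BeginsWithMarker m T →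
                      t ++ T ≡ t′ ++ Q → StartsWith t t′
  markerFree-prefix t       []       T Q _ _ _ _ = t , refl
  markerFree-prefix []      (x ∷ t′) T Q _ _ (inj₁ refl) ()
  markerFree-prefix []      (x ∷ t′) T Q _ (x≢m ∷ _) (inj₂ (_ , refl)) eq =
    ⊥-elim (x≢m (sym (proj₁ (∷-injective eq))))
  markerFree-prefix (x ∷ t) (y ∷ t′) T Q (_ ∷ mf) (_ ∷ mf′) bT eq with ∷-injective eq
  ... | refl , eq′ with markerFree-prefix t t′ T Q mf mf′ bT eq′
  ... | R , refl = R , refl

  markerFree-++-cancel : ∀ t t′ A B → MarkerFree m t → MarkerFree m t′ →
                         BeginsWithMarker m A → BeginsWithMarker m B →
                         t ++ A ≡ t′ ++ B → t ≡ t′ × A ≡ B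
  markerFree-++-cancel []      []       A B _ _ _ _ eq = refl , eq
  markerFree-++-cancel []      (x ∷ t′) A B _ (x≢m ∷ _) (inj₁ refl) _ ()
  markerFree-++-cancel []      (x ∷ t′) A B _ (x≢m ∷ _) (inj₂ (_ , refl)) _ eq =
    ⊥-elim (x≢m (sym (proj₁ (∷-injective eq))))
  markerFree-++-cancel (x ∷ t) []       A B (x≢m ∷ _) _ _ (inj₁ refl) ()
  markerFree-++-cancel (x ∷ t) []       A B (x≢m ∷ _) _ _ (inj₂ (_ , refl)) eq =
    ⊥-elim (x≢m (proj₁ (∷-injective eq)))
  markerFree-++-cancel (x ∷ t) (y ∷ t′) A B (_ ∷ mf) (_ ∷ mf′) bA bB eq with ∷-injective eq
  ... | refl , eq′ with markerFree-++-cancel t t′ A B mf mf′ bA bB eq′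
  ... | refl , A≡B = refl , A≡B

  H-injective : ∀ U V → H U ≡ H V → U ≡ V
  H-injective []      []      eq = refl
  H-injective []      (v ∷ V) eq = ⊥-elim ([]≢++∷ [] (trans eq (h-++ v (H V))))
  H-injective (u ∷ U) []      eq = ⊥-elim ([]≢++∷ [] (trans (sym eq) (h-++ u (H U))))
  H-injective (u ∷ U) (v ∷ V) eq
    with markerFree-++-cancel (body u) (body v) (H U) (H V) (body-markerFree u) (body-markerFree v)
           (H-beginsWithMarker U) (H-beginsWithMarker V)
           (proj₂ (∷-injective (trans (sym (h-++ u (H U))) (trans eq (h-++ v (H V))))))
  ... | bu≡bv , HU≡HV = cong₂ _∷_ (body-injective bu≡bv) (H-injective U V HU≡HV)

  split-at-marker : ∀ U X R → H U ≡ X ++ m ∷ R →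
                    ∃[ U₁ ] ∃[ U₂ ] (U ≡ U₁ ++ U₂ × H U₁ ≡ X × H U₂ ≡ m ∷ R)
  split-at-marker []      X R eq = ⊥-elim ([]≢++∷ X eq)
  split-at-marker (u ∷ U) X R eq with ++-split (h u) (H U) X (m ∷ R) eq
  ... | inj₁ (M , X≡ , HU≡) with split-at-marker U M R HU≡
  ...   | U₁ , U₂ , refl , refl , e = u ∷ U₁ , U₂ , refl , sym X≡ , e
  split-at-marker (u ∷ U) X R eq | inj₂ ([] , hu≡ , e) =
    [ u ] , U , refl , trans (++-identityʳ (h u)) (trans hu≡ (++-identityʳ X)) , sym e
  split-at-marker (u ∷ U) X R eq | inj₂ (c ∷ M , hu≡ , refl) with marker-starts-block u X M hu≡
  ... | refl = [] , u ∷ U , refl , refl , eq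

  h-not-markerFree : ∀ e → ¬ MarkerFree m (h e)
  h-not-markerFree e mf with subst (MarkerFree m) (h≡m∷body e) mf
  ... | m≢m ∷ _ = m≢m refl

  H-suffix-decode : ∀ U Y z → H U ≡ Y ++ H z → ∃[ U′ ] (U ≡ U′ ++ z × H U′ ≡ Y)
  H-suffix-decode U Y []      eq = U , sym (++-identityʳ U) , trans eq (++-identityʳ Y)
  H-suffix-decode U Y (e ∷ z) eq
    with split-at-marker U Y (body e ++ H z) (trans eq (cong (Y ++_) (h-++ e (H z))))
  ... | U₁ , U₂ , refl , HU₁≡Y , HU₂≡ =
    U₁ , cong (U₁ ++_) (H-injective U₂ (e ∷ z) (trans HU₂≡ (sym (h-++ e (H z))))) , HU₁≡Y

  suffix-of-H : ∀ U P v → H U ≡ P ++ v → ∃[ s ] ∃[ z ] (v ≡ s ++ H z × MarkerFree m s)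
  suffix-of-H []      []      []      eq = [] , [] , refl , []
  suffix-of-H (u ∷ U) P       v       eq with ++-split (h u) (H U) P v eq
  ... | inj₁ (M , _ , HU≡) = suffix-of-H U M v HU≡
  ... | inj₂ (M , hu≡ , v≡) with block-suffix u P M hu≡
  ...   | inj₁ (_ , refl) = [] , u ∷ U , v≡ , []
  ...   | inj₂ mf         = M , U , v≡ , mf

  last-block : ∀ U P a s → MarkerFree m s → H U ≡ P ++ a ∷ s →
               ∃[ U′ ] ∃[ E ] (U ≡ U′ ++ [ E ] × EndsWith (h E) (a ∷ s))
  last-block U P a s mf eq with reverseView U
  ... | [] = ⊥-elim ([]≢++∷ P eq)
  ... | U′ ∶ _ ∶ʳ E with ++-split P (a ∷ s) (H U′) (h E) (trans (sym eq) (H-∷ʳ U′ E))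
  ...   | inj₂ (M , _ , hE≡) = U′ , E , refl , M , hE≡
  ...   | inj₁ ([] , _ , a∷s≡) = U′ , E , refl , [] , sym a∷s≡
  ...   | inj₁ (c ∷ M , _ , a∷s≡) =
    ⊥-elim (h-not-markerFree E (++⁻ʳ M (subst (MarkerFree m) (proj₂ (∷-injective a∷s≡)) mf)))

  first-block : ∀ U t Q → MarkerFree m t → H U ≡ m ∷ t ++ Q →
                ∃[ e ] ∃[ U′ ] (U ≡ e ∷ U′ × StartsWith (h e) (m ∷ t))
  first-block (e ∷ U′) t Q mf eq
    with markerFree-prefix (body e) t (H U′) Q (body-markerFree e) mf (H-beginsWithMarker U′)
           (proj₂ (∷-injective (trans (sym (h-++ e (H U′))) eq)))
  ... | R , bₑ≡ = e , U′ , refl , R , trans (h≡m∷body e) (cong (m ∷_) bₑ≡)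

  lift-aligned-occurrence : ∀ {U} z {t} → MarkerFree m t → Infix (H z ++ m ∷ t) (H U) →
                            ∃[ e′ ] (Infix (z ++ [ e′ ]) U × StartsWith (h e′) (m ∷ t))
  lift-aligned-occurrence {U} z {t} mf (P , Q , eq)
    with split-at-marker U (P ++ H z) (t ++ Q) (trans eq (++-regroup P (H z) (m ∷ t) Q))
  ... | U₁ , U₂ , refl , HU₁≡ , HU₂≡ with first-block U₂ t Q mf HU₂≡ | H-suffix-decode U₁ P z HU₁≡
  ...   | e′ , U″ , refl , pre | U′ , refl , _ = e′ , (U′ , U″ , sym (++-regroup U′ z [ e′ ] U″)) , pre

  extend-to-block-start : ∀ {U a s z t} → MarkerFree m s → Infix (a ∷ s ++ H z ++ m ∷ t) (H U) →
                          ∃[ E ] (EndsWith (h E) (a ∷ s) × Infix (H (E ∷ z) ++ m ∷ t) (H U))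
  extend-to-block-start {U} {a} {s} {z} {t} mf (P , Q , eq)
    with split-at-marker U ((P ++ a ∷ s) ++ H z) (t ++ Q) (trans eq (reassoc P [ a ] s (H z) [ m ] t Q))
    where
    reassoc : ∀ (P A S Z M T Q : Word) → P ++ (A ++ S ++ Z ++ M ++ T) ++ Q ≡ ((P ++ A ++ S) ++ Z) ++ M ++ T ++ Q
    reassoc P A S Z M T Q = solve (++-monoid Σ₃)
  ... | U₁ , U₂ , refl , HU₁≡ , HU₂≡ with H-suffix-decode U₁ (P ++ a ∷ s) z HU₁≡
  ...   | U₄ , refl , HU₄≡ with last-block U₄ P a s mf HU₄≡
  ...     | U₀ , E , refl , suf = E , suf , H U₀ , Q , (begin
    H (((U₀ ++ [ E ]) ++ z) ++ U₂)             ≡⟨ cong H (reassoc U₀ [ E ] z U₂) ⟩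
    H (U₀ ++ (E ∷ z) ++ U₂)                    ≡⟨ H-++ U₀ ((E ∷ z) ++ U₂) ⟩
    H U₀ ++ H ((E ∷ z) ++ U₂)                  ≡⟨ cong (H U₀ ++_) (H-++ (E ∷ z) U₂) ⟩
    H U₀ ++ H (E ∷ z) ++ H U₂                  ≡⟨ cong (λ X → H U₀ ++ H (E ∷ z) ++ X) HU₂≡ ⟩
    H U₀ ++ H (E ∷ z) ++ m ∷ t ++ Q            ≡⟨ cong (H U₀ ++_) (sym (++-assoc (H (E ∷ z)) (m ∷ t) Q)) ⟩
    H U₀ ++ (H (E ∷ z) ++ m ∷ t) ++ Q          ∎)
    where
    open ≡-Reasoning
    reassoc : ∀ (A B C D : Word) → ((A ++ B) ++ C) ++ D ≡ A ++ (B ++ C) ++ D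
    reassoc A B C D = solve (++-monoid Σ₃)

  lift-occurrence : ∀ {U a s z t} → MarkerFree m s → MarkerFree m t →
                    Infix (a ∷ s ++ H z ++ m ∷ t) (H U) →
                    ∃[ E ] ∃[ e′ ] (Infix (E ∷ z ++ [ e′ ]) U × EndsWith (h E) (a ∷ s) × StartsWith (h e′) (m ∷ t))
  lift-occurrence {U} {z = z} mfs mft occ =
    let E , suf , occ′   = extend-to-block-start {U} {z = z} mfs occ
        e′ , occ″ , pre = lift-aligned-occurrence {U} (E ∷ z) mft occ′
    in E , e′ , occ″ , suf , pre

  decompose-before-marker : ∀ {U v t} → Infix (v ++ m ∷ t) (H U) → ∃[ s ] ∃[ z ] (v ≡ s ++ H z × MarkerFree m s)
  decompose-before-marker {U} {v} {t} (P , Q , eq)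
    with split-at-marker U (P ++ v) (t ++ Q) (trans eq (++-regroup P v (m ∷ t) Q))
  ... | U₁ , _ , _ , HU₁≡ , _ = suffix-of-H U₁ P v HU₁≡

f-body : Σ₃ → Word
f-body c0 = c1 ∷ []
f-body c1 = c2 ∷ c2 ∷ []
f-body c2 = c2 ∷ []

g-body : Σ₃ → Word
g-body c0 = c0 ∷ []
g-body c1 = c1 ∷ []
g-body c2 = []

f≡0∷f-body : ∀ e → f e ≡ c0 ∷ f-body e
f≡0∷f-body c0 = refl
f≡0∷f-body c1 = refl
f≡0∷f-body c2 = refl

g≡2∷g-body : ∀ e → g e ≡ c2 ∷ g-body e
g≡2∷g-body c0 = refl
g≡2∷g-body c1 = refl
g≡2∷g-body c2 = refl

f-body-markerFree : ∀ e → MarkerFree c0 (f-body e)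
f-body-markerFree c0 = (λ ()) ∷ []
f-body-markerFree c1 = (λ ()) ∷ (λ ()) ∷ []
f-body-markerFree c2 = (λ ()) ∷ []

g-body-markerFree : ∀ e → MarkerFree c2 (g-body e)
g-body-markerFree c0 = (λ ()) ∷ []
g-body-markerFree c1 = (λ ()) ∷ []
g-body-markerFree c2 = []

f-body-injective : ∀ {e e′} → f-body e ≡ f-body e′ → e ≡ e′
f-body-injective {c0} {c0} _ = refl
f-body-injective {c1} {c1} _ = refl
f-body-injective {c2} {c2} _ = refl

g-body-injective : ∀ {e e′} → g-body e ≡ g-body e′ → e ≡ e′
g-body-injective {c0} {c0} _ = refl
g-body-injective {c1} {c1} _ = refl
g-body-injective {c2} {c2} _ = refl

module f-code = MarkerCode f c0 f-body f≡0∷f-body f-body-markerFree f-body-injective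
module g-code = MarkerCode g c2 g-body g≡2∷g-body g-body-markerFree g-body-injective

Factors : (ℕ → Word) → Word → Set
Factors T w = ∃[ k ] Infix w (T k)

Factors-infix : ∀ {T u w} → Infix u w → Factors T w → Factors T u
Factors-infix u⊑w (k , w⊑T) = k , infix-trans u⊑w w⊑T

Factors-prefix : ∀ {T} u v → Factors T (u ++ v) → Factors T u
Factors-prefix u v = Factors-infix ([] , v , refl)

Factors-suffix : ∀ {T} u v → Factors T (u ++ v) → Factors T v
Factors-suffix u v = Factors-infix (suffix⇒infix (u , refl))

RightSpecialIn : (Word → Set) → Word → Set
RightSpecialIn L w = ∃[ a ] ∃[ b ] (a ≢ b × L (w ++ [ a ]) × L (w ++ [ b ]))

RightSpecial-suffix : ∀ {T} u w → RightSpecialIn (Factors T) (u ++ w) → RightSpecialIn (Factors T) w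
RightSpecial-suffix u w (a , b , a≢b , La , Lb) =
  a , b , a≢b , Factors-suffix u (w ++ [ a ]) (subst (Factors _) (++-assoc u w [ a ]) La)
              , Factors-suffix u (w ++ [ b ]) (subst (Factors _) (++-assoc u w [ b ]) Lb)

fᵏ0 : ℕ → Word
fᵏ0 k = iter k f [ c0 ]

Lx : Word → Set
Lx = Factors fᵏ0

Ly : Word → Set
Ly = Factors (λ k → morph g (fᵏ0 k))

fᵏ0-grows : ∀ k → ∃[ t ] ∃[ T ] (fᵏ0 (suc k) ≡ fᵏ0 k ++ t ∷ T)
fᵏ0-grows zero = c1 , [] , refl
fᵏ0-grows (suc k) with fᵏ0-grows k
... | t , T , eq = c0 , f-body t ++ morph f T , (begin
  morph f (fᵏ0 (suc k))                      ≡⟨ cong (morph f) eq ⟩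
  morph f (fᵏ0 k ++ t ∷ T)                   ≡⟨ f-code.H-++ (fᵏ0 k) (t ∷ T) ⟩
  fᵏ0 (suc k) ++ f t ++ morph f T            ≡⟨ cong (fᵏ0 (suc k) ++_) (f-code.h-++ t (morph f T)) ⟩
  fᵏ0 (suc k) ++ c0 ∷ f-body t ++ morph f T  ∎)
  where open ≡-Reasoning

Lx-extendʳ : ∀ {w} → Lx w → ∃[ c ] Lx (w ++ [ c ])
Lx-extendʳ {w} (k , P , [] , eq) with fᵏ0-grows k
... | t , T , eq′ = t , suc k , P , T , (begin
  fᵏ0 (suc k)             ≡⟨ eq′ ⟩
  fᵏ0 k ++ t ∷ T          ≡⟨ cong (_++ t ∷ T) eq ⟩
  (P ++ w ++ []) ++ t ∷ T ≡⟨ solve (++-monoid Σ₃) ⟩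
  P ++ (w ++ [ t ]) ++ T  ∎)
  where open ≡-Reasoning
Lx-extendʳ {w} (k , P , q ∷ Q , eq) = q , k , P , Q , trans eq (cong (P ++_) (sym (++-assoc w [ q ] Q)))

Lx-morph-f : ∀ {w} → Lx w → Lx (morph f w)
Lx-morph-f (k , occ) = suc k , Infix-morph f occ

Lx-f-∷ʳ : ∀ w e → Lx (w ++ [ e ]) → Lx (morph f w ++ f e)
Lx-f-∷ʳ w e Lw = subst Lx (f-code.H-∷ʳ w e) (Lx-morph-f Lw)

Lx⇒Ly : ∀ {w} → Lx w → Ly (morph g w)
Lx⇒Ly (k , occ) = k , Infix-morph g occ

Lx-in-f-image : ∀ {w} → Lx w → ∃[ k ] Infix w (morph f (fᵏ0 k))
Lx-in-f-image {w} (zero , P , Q , eq) = 0 , P , Q ++ [ c1 ] , trans (cong (_++ [ c1 ]) eq) (solve (++-monoid Σ₃))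
Lx-in-f-image (suc k , occ) = k , occ

Lx-∷-∷ʳ-++ : ∀ {x q b t} → Lx (x ∷ (q ++ [ b ]) ++ t) → Lx (x ∷ q ++ b ∷ t)
Lx-∷-∷ʳ-++ {x} {q} {b} {t} = subst (λ w → Lx (x ∷ w)) (∷ʳ-++ q b t)

-- Factors of length two and three

module Windows (Adj : Σ₃ → Σ₃ → Set) (Tri : Σ₃ → Σ₃ → Σ₃ → Set) where

  Admissible : Word → Set
  Admissible (a ∷ b ∷ c ∷ w) = Adj a b × Tri a b c × Admissible (b ∷ c ∷ w)
  Admissible (a ∷ b ∷ [])    = Adj a b
  Admissible _               = ⊤

  admissible-∷⁻ : ∀ a w → Admissible (a ∷ w) → Admissible w
  admissible-∷⁻ a []               _           = tt
  admissible-∷⁻ a (b ∷ [])         _           = tt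
  admissible-∷⁻ a (b ∷ c ∷ w)      (_ , _ , ad) = ad

  admissible-++⁻ʳ : ∀ P w → Admissible (P ++ w) → Admissible w
  admissible-++⁻ʳ []      w ad = ad
  admissible-++⁻ʳ (a ∷ P) w ad = admissible-++⁻ʳ P w (admissible-∷⁻ a (P ++ w) ad)

  admissible-++⁻ˡ : ∀ w Q → Admissible (w ++ Q) → Admissible w
  admissible-++⁻ˡ []              Q       _              = tt
  admissible-++⁻ˡ (a ∷ [])        Q       _              = tt
  admissible-++⁻ˡ (a ∷ b ∷ [])    []      ad             = ad
  admissible-++⁻ˡ (a ∷ b ∷ [])    (c ∷ Q) (ab , _ , _)   = ab
  admissible-++⁻ˡ (a ∷ b ∷ c ∷ w) Q       (ab , abc , ad) = ab , abc , admissible-++⁻ˡ (b ∷ c ∷ w) Q ad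

  admissible-infix : ∀ {w L} → Infix w L → Admissible L → Admissible w
  admissible-infix {w} (P , Q , refl) ad = admissible-++⁻ˡ w Q (admissible-++⁻ʳ P (w ++ Q) ad)

  admissible-pair : ∀ {a b} w → Admissible (a ∷ b ∷ w) → Adj a b
  admissible-pair []      ab          = ab
  admissible-pair (c ∷ w) (ab , _ , _) = ab

data Adjacentˣ : Σ₃ → Σ₃ → Set where
  p01 : Adjacentˣ c0 c1
  p02 : Adjacentˣ c0 c2
  p10 : Adjacentˣ c1 c0
  p20 : Adjacentˣ c2 c0
  p22 : Adjacentˣ c2 c2

Not222 : Σ₃ → Σ₃ → Σ₃ → Set
Not222 c2 c2 c2 = ⊥
Not222 _  _  _  = ⊤

data Adjacentʸ : Σ₃ → Σ₃ → Set where
  p2∗ : ∀ {b} → Adjacentʸ c2 b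
  p02 : Adjacentʸ c0 c2
  p12 : Adjacentʸ c1 c2

module Wˣ = Windows Adjacentˣ Not222
module Wʸ = Windows Adjacentʸ (λ _ _ _ → ⊤)

f-block-admissible : ∀ e T → BeginsWithMarker c0 T → Wˣ.Admissible T → Wˣ.Admissible (f e ++ T)
f-block-admissible c0 []           _ _  = p01
f-block-admissible c0 (_ ∷ [])     (inj₂ (_ , refl)) _ = p01 , tt , p10
f-block-admissible c0 (_ ∷ t ∷ T)  (inj₂ (_ , refl)) ad = p01 , tt , p10 , tt , ad
f-block-admissible c1 []           _ _  = p02 , tt , p22
f-block-admissible c1 (_ ∷ [])     (inj₂ (_ , refl)) _ = p02 , tt , p22 , tt , p20
f-block-admissible c1 (_ ∷ t ∷ T)  (inj₂ (_ , refl)) ad = p02 , tt , p22 , tt , p20 , tt , ad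
f-block-admissible c2 []           _ _  = p02
f-block-admissible c2 (_ ∷ [])     (inj₂ (_ , refl)) _ = p02 , tt , p20
f-block-admissible c2 (_ ∷ t ∷ T)  (inj₂ (_ , refl)) ad = p02 , tt , p20 , tt , ad

g-block-admissible : ∀ e T → BeginsWithMarker c2 T → Wʸ.Admissible T → Wʸ.Admissible (g e ++ T)
g-block-admissible c0 []          _                 _  = p2∗
g-block-admissible c0 (_ ∷ [])    (inj₂ (_ , refl)) _  = p2∗ , tt , p02
g-block-admissible c0 (_ ∷ _ ∷ _) (inj₂ (_ , refl)) ad = p2∗ , tt , p02 , tt , ad
g-block-admissible c1 []          _                 _  = p2∗
g-block-admissible c1 (_ ∷ [])    (inj₂ (_ , refl)) _  = p2∗ , tt , p12
g-block-admissible c1 (_ ∷ _ ∷ _) (inj₂ (_ , refl)) ad = p2∗ , tt , p12 , tt , ad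
g-block-admissible c2 []          _                 _  = tt
g-block-admissible c2 (_ ∷ [])    (inj₂ (_ , refl)) _  = p2∗
g-block-admissible c2 (_ ∷ _ ∷ _) (inj₂ (_ , refl)) ad = p2∗ , tt , ad

f-image-admissible : ∀ U → Wˣ.Admissible (morph f U)
f-image-admissible []      = tt
f-image-admissible (u ∷ U) = f-block-admissible u (morph f U) (f-code.H-beginsWithMarker U) (f-image-admissible U)

g-image-admissible : ∀ U → Wʸ.Admissible (morph g U)
g-image-admissible []      = tt
g-image-admissible (u ∷ U) = g-block-admissible u (morph g U) (g-code.H-beginsWithMarker U) (g-image-admissible U)

Lx⇒admissible : ∀ {w} → Lx w → Wˣ.Admissible w
Lx⇒admissible {w} Lw with Lx-in-f-image Lw
... | k , occ = Wˣ.admissible-infix occ (f-image-admissible (fᵏ0 k))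

Ly⇒admissible : ∀ {w} → Ly w → Wʸ.Admissible w
Ly⇒admissible (k , occ) = Wʸ.admissible-infix occ (g-image-admissible (fᵏ0 k))

adjacentˣ-at-end : ∀ p {a b} → Lx (p ++ a ∷ b ∷ []) → Adjacentˣ a b
adjacentˣ-at-end p Lw =
  Wˣ.admissible-pair [] (Wˣ.admissible-infix (suffix⇒infix (p , refl)) (Lx⇒admissible Lw))

adjacentʸ-at-end : ∀ p {a b} → Ly (p ++ a ∷ b ∷ []) → Adjacentʸ a b
adjacentʸ-at-end p Lw = Wʸ.admissible-pair [] (Wʸ.admissible-infix (suffix⇒infix (p , refl)) (Ly⇒admissible Lw))

adjacentˣ-at-start : ∀ {a b} w → Lx (a ∷ b ∷ w) → Adjacentˣ a b
adjacentˣ-at-start w Lw = Wˣ.admissible-pair w (Lx⇒admissible Lw)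

before-22 : ∀ p {b} → Lx (p ++ b ∷ c2 ∷ c2 ∷ []) → b ≡ c0
before-22 p Lw with Wˣ.admissible-infix (suffix⇒infix (p , refl)) (Lx⇒admissible Lw)
... | p02 , _  , _ = refl
... | p22 , () , _

adjacent-after-0 : ∀ {E b} → Adjacentˣ c0 b → Adjacentˣ E b → E ≢ c0 → E ≡ c2
adjacent-after-0 p01 p01 E≢0 = ⊥-elim (E≢0 refl)
adjacent-after-0 p02 p02 E≢0 = ⊥-elim (E≢0 refl)
adjacent-after-0 p02 p22 _   = refl

-- Right special factors of x

RSx : Word → Set
RSx = RightSpecialIn Lx

RSx-extensions : ∀ p {l} → RSx (p ++ [ l ]) →
                 ∃[ a ] ∃[ b ] (a ≢ b × Lx (p ++ l ∷ a ∷ []) × Lx (p ++ l ∷ b ∷ []))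
RSx-extensions p {l} (a , b , a≢b , La , Lb) =
  a , b , a≢b , subst Lx (++-assoc p [ l ] [ a ]) La , subst Lx (++-assoc p [ l ] [ b ]) Lb

no-RSx-ending-in-1 : ∀ p → ¬ RSx (p ++ [ c1 ])
no-RSx-ending-in-1 p rs with RSx-extensions p rs
... | a , b , a≢b , La , Lb with adjacentˣ-at-end p La | adjacentˣ-at-end p Lb
...   | p10 | p10 = a≢b refl

RSx-ending-in-0 : ∀ p → RSx (p ++ [ c0 ]) → Lx (p ++ c0 ∷ c1 ∷ []) × Lx (p ++ c0 ∷ c2 ∷ [])
RSx-ending-in-0 p rs with RSx-extensions p rs
... | a , b , a≢b , La , Lb with adjacentˣ-at-end p La | adjacentˣ-at-end p Lb
...   | p01 | p01 = ⊥-elim (a≢b refl)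
...   | p01 | p02 = La , Lb
...   | p02 | p01 = Lb , La
...   | p02 | p02 = ⊥-elim (a≢b refl)

RSx-ending-in-2 : ∀ p → RSx (p ++ [ c2 ]) → Lx (p ++ c2 ∷ c0 ∷ []) × Lx (p ++ c2 ∷ c2 ∷ [])
RSx-ending-in-2 p rs with RSx-extensions p rs
... | a , b , a≢b , La , Lb with adjacentˣ-at-end p La | adjacentˣ-at-end p Lb
...   | p20 | p20 = ⊥-elim (a≢b refl)
...   | p20 | p22 = La , Lb
...   | p22 | p20 = Lb , La
...   | p22 | p22 = ⊥-elim (a≢b refl)

-- Every right special factor of x ending in 0 (resp. 2) is a suffix of some α k (resp. β k).
mutual
  α : ℕ → Word
  α zero    = [ c0 ]
  α (suc k) = morph f (β k) ++ [ c0 ]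

  β : ℕ → Word
  β zero    = [ c2 ]
  β (suc k) = morph f (α k) ++ c0 ∷ c2 ∷ []

mutual
  α-1 : ∀ k → Lx (α k ++ [ c1 ])
  α-1 zero    = 1 , [] , [] , refl
  α-1 (suc k) = subst Lx (sym (++-assoc (morph f (β k)) [ c0 ] [ c1 ])) (Lx-f-∷ʳ (β k) c0 (β-0 k))

  α-2 : ∀ k → Lx (α k ++ [ c2 ])
  α-2 zero    = 2 , c0 ∷ c1 ∷ [] , [ c2 ] , refl
  α-2 (suc k) = subst Lx (sym (++-assoc (morph f (β k)) [ c0 ] [ c2 ])) (Lx-f-∷ʳ (β k) c2 (β-2 k))

  β-0 : ∀ k → Lx (β k ++ [ c0 ])
  β-0 zero    = 3 , c0 ∷ c1 ∷ c0 ∷ c2 ∷ [] , c1 ∷ c0 ∷ c2 ∷ c0 ∷ c2 ∷ [] , refl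
  β-0 (suc k) with Lx-extendʳ (α-2 k)
  ... | c , Lw = Factors-prefix (β (suc k) ++ [ c0 ]) (f-body c) (subst Lx (begin
    morph f ((α k ++ [ c2 ]) ++ [ c ])                 ≡⟨ f-code.H-∷ʳ (α k ++ [ c2 ]) c ⟩
    morph f (α k ++ [ c2 ]) ++ f c                     ≡⟨ cong₂ _++_ (f-code.H-∷ʳ (α k) c2) (f≡0∷f-body c) ⟩
    (morph f (α k) ++ c0 ∷ c2 ∷ []) ++ c0 ∷ f-body c   ≡⟨ sym (++-assoc (β (suc k)) [ c0 ] (f-body c)) ⟩
    (β (suc k) ++ [ c0 ]) ++ f-body c                  ∎) (Lx-morph-f Lw))
    where open ≡-Reasoning

  β-2 : ∀ k → Lx (β k ++ [ c2 ])
  β-2 zero    = 3 , c0 ∷ c1 ∷ c0 ∷ [] , c0 ∷ c1 ∷ c0 ∷ c2 ∷ c0 ∷ c2 ∷ [] , refl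
  β-2 (suc k) = subst Lx (sym (++-assoc (morph f (α k)) (c0 ∷ c2 ∷ []) [ c2 ])) (Lx-f-∷ʳ (α k) c1 (α-1 k))

α-RSx : ∀ k → RSx (α k)
α-RSx k = c1 , c2 , (λ ()) , α-1 k , α-2 k

β-RSx : ∀ k → RSx (β k)
β-RSx k = c0 , c2 , (λ ()) , β-0 k , β-2 k

α-ends-with-0 : ∀ k → EndsWith (α k) [ c0 ]
α-ends-with-0 zero    = [] , refl
α-ends-with-0 (suc k) = morph f (β k) , refl

β-ends-with-2 : ∀ k → EndsWith (β k) [ c2 ]
β-ends-with-2 zero    = [] , refl
β-ends-with-2 (suc k) = morph f (α k) ++ [ c0 ] , sym (++-assoc (morph f (α k)) [ c0 ] [ c2 ])

mutual
  α-suffix-of-next : ∀ k → EndsWith (α (suc k)) (α k)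
  α-suffix-of-next zero    = c0 ∷ c2 ∷ [] , refl
  α-suffix-of-next (suc k) = suffix-++ [ c0 ] (EndsWith-morph f (β-suffix-of-next k))

  β-suffix-of-next : ∀ k → EndsWith (β (suc k)) (β k)
  β-suffix-of-next zero    = c0 ∷ c1 ∷ c0 ∷ [] , refl
  β-suffix-of-next (suc k) = suffix-++ (c0 ∷ c2 ∷ []) (EndsWith-morph f (α-suffix-of-next k))

mutual
  α-long : ∀ k → k < length (α k)
  α-long zero    = s≤s z≤n
  α-long (suc k) = ≤-trans (s≤s (≤-trans (β-long k) (f-code.length-H (β k))))
                           (length-++-∷ (morph f (β k)) c0 [])

  β-long : ∀ k → k < length (β k)
  β-long zero    = s≤s z≤n
  β-long (suc k) = ≤-trans (s≤s (≤-trans (α-long k) (f-code.length-H (α k))))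
                           (length-++-∷ (morph f (α k)) c0 [ c2 ])

data FSuffix : Σ₃ → Word → Set where
  s01  : FSuffix c0 (c0 ∷ c1 ∷ [])
  s1   : FSuffix c0 (c1 ∷ [])
  s022 : FSuffix c1 (c0 ∷ c2 ∷ c2 ∷ [])
  s22  : FSuffix c1 (c2 ∷ c2 ∷ [])
  s2₁  : FSuffix c1 (c2 ∷ [])
  s02  : FSuffix c2 (c0 ∷ c2 ∷ [])
  s2₂  : FSuffix c2 (c2 ∷ [])

f-suffix : ∀ {E a s} → EndsWith (f E) (a ∷ s) → FSuffix E (a ∷ s)
f-suffix {c0} ([]        , refl) = s01
f-suffix {c0} (_ ∷ []    , refl) = s1
f-suffix {c1} ([]        , refl) = s022
f-suffix {c1} (_ ∷ []    , refl) = s22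
f-suffix {c1} (_ ∷ _ ∷ [] , refl) = s2₁
f-suffix {c2} ([]        , refl) = s02
f-suffix {c2} (_ ∷ []    , refl) = s2₂
f-suffix {c0} (_ ∷ _ ∷ [] , ())
f-suffix {c0} (_ ∷ _ ∷ _ ∷ _ , ())
f-suffix {c1} (_ ∷ _ ∷ _ ∷ [] , ())
f-suffix {c1} (_ ∷ _ ∷ _ ∷ _ ∷ _ , ())
f-suffix {c2} (_ ∷ _ ∷ [] , ())
f-suffix {c2} (_ ∷ _ ∷ _ ∷ _ , ())

FSuffix-unique : ∀ {E E′ w} → FSuffix E w → FSuffix E′ w → w ≢ [ c2 ] → E ≡ E′
FSuffix-unique s01  s01  _   = refl
FSuffix-unique s1   s1   _   = refl
FSuffix-unique s022 s022 _   = refl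
FSuffix-unique s22  s22  _   = refl
FSuffix-unique s2₁  _    w≢2 = ⊥-elim (w≢2 refl)
FSuffix-unique s02  s02  _   = refl
FSuffix-unique s2₂  _    w≢2 = ⊥-elim (w≢2 refl)

FSuffix-first-letter : ∀ {E E′ a a′ s} → FSuffix E (a ∷ s) → FSuffix E′ (a′ ∷ s) → a ≢ a′ →
                       a ∷ s ≢ [ c2 ] → a′ ∷ s ≢ [ c2 ] → (E ≡ c1 × E′ ≡ c2) ⊎ (E ≡ c2 × E′ ≡ c1)
FSuffix-first-letter s01  s01  a≢a′ _ _   = ⊥-elim (a≢a′ refl)
FSuffix-first-letter s1   s1   a≢a′ _ _   = ⊥-elim (a≢a′ refl)
FSuffix-first-letter s1   s2₁  _    _ w≢2 = ⊥-elim (w≢2 refl)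
FSuffix-first-letter s1   s2₂  _    _ w≢2 = ⊥-elim (w≢2 refl)
FSuffix-first-letter s022 s022 a≢a′ _ _   = ⊥-elim (a≢a′ refl)
FSuffix-first-letter s22  s22  a≢a′ _ _   = ⊥-elim (a≢a′ refl)
FSuffix-first-letter s22  s02  _    _ _   = inj₁ (refl , refl)
FSuffix-first-letter s2₁  _    _ w≢2 _    = ⊥-elim (w≢2 refl)
FSuffix-first-letter s02  s22  _    _ _   = inj₂ (refl , refl)
FSuffix-first-letter s02  s02  a≢a′ _ _   = ⊥-elim (a≢a′ refl)
FSuffix-first-letter s2₂  _    _ w≢2 _    = ⊥-elim (w≢2 refl)

FSuffix-1 : ∀ {E a} → FSuffix E [ a ] → a ≢ c2 → E ≡ c0
FSuffix-1 s1  _   = refl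
FSuffix-1 s2₁ a≢2 = ⊥-elim (a≢2 refl)
FSuffix-1 s2₂ a≢2 = ⊥-elim (a≢2 refl)

FSuffix-2 : ∀ {E} → FSuffix E [ c2 ] → E ≢ c0
FSuffix-2 s2₁ ()
FSuffix-2 s2₂ ()

f-prefix-01 : ∀ {e} → StartsWith (f e) (c0 ∷ c1 ∷ []) → e ≡ c0
f-prefix-01 {c0} _ = refl

f-prefix-02 : ∀ {e} → StartsWith (f e) (c0 ∷ c2 ∷ []) → e ≢ c0
f-prefix-02 {c0} (_ , ()) 

f-prefix-022 : ∀ {e} → StartsWith (f e) (c0 ∷ c2 ∷ c2 ∷ []) → e ≡ c1
f-prefix-022 {c1} _ = refl

lift-x : ∀ {a s z t} → MarkerFree c0 s → MarkerFree c0 t → Lx (a ∷ s ++ morph f z ++ c0 ∷ t) →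
         ∃[ E ] ∃[ e′ ] (FSuffix E (a ∷ s) × StartsWith (f e′) (c0 ∷ t) × Lx (E ∷ z ++ [ e′ ]))
lift-x {z = z} mfs mft Lw =
  let k , occ                   = Lx-in-f-image Lw
      E , e′ , occ′ , suf , pre = f-code.lift-occurrence {U = fᵏ0 k} {z = z} mfs mft occ
  in E , e′ , f-suffix suf , pre , k , occ′

decompose-x : ∀ {v t} → Lx (v ++ c0 ∷ t) → ∃[ s ] ∃[ z ] (v ≡ s ++ morph f z × MarkerFree c0 s)
decompose-x Lw = let k , occ = Lx-in-f-image Lw in f-code.decompose-before-marker {U = fᵏ0 k} occ

length-≤-decomposition : ∀ {q} s z → q ≡ s ++ morph f z → length z ≤ length q
length-≤-decomposition s z refl = ≤-trans (f-code.length-H z) (length-++-≤ʳ (morph f z) {s})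

-- Desubstitution of the two right extensions e₁, e₂ of a ∷ s ++ f(z): the blocks E₁, E₂
-- both end with a ∷ s, and E₁ z e₁, E₂ z e₂ are factors of x.
Preimage : Σ₃ → Word → Word → Σ₃ → Σ₃ → Set
Preimage a s z e₁ e₂ = ∃[ E₁ ] ∃[ E₂ ]
  (FSuffix E₁ (a ∷ s) × FSuffix E₂ (a ∷ s) × Lx (E₁ ∷ z ++ [ e₁ ]) × Lx (E₂ ∷ z ++ [ e₂ ]))

preimage-of-0-extensions : ∀ {a q s z} → q ≡ s ++ morph f z → MarkerFree c0 s →
                           Lx (a ∷ q ++ c0 ∷ c1 ∷ []) → Lx (a ∷ q ++ c0 ∷ c2 ∷ []) →
                           ∃[ e ] (c0 ≢ e × Preimage a s z c0 e)
preimage-of-0-extensions {a} {s = s} {z} refl mf L₁ L₂ =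
  let E₁ , e₁ , s₁ , pre₁ , LE₁ = lift-x {t = [ c1 ]} mf ((λ ()) ∷ []) (Lx-reassoc L₁)
      E₂ , e₂ , s₂ , pre₂ , LE₂ = lift-x {t = [ c2 ]} mf ((λ ()) ∷ []) (Lx-reassoc L₂)
  in e₂ , (λ 0≡e₂ → f-prefix-02 pre₂ (sym 0≡e₂)) , E₁ , E₂ , s₁ , s₂ ,
     subst (λ e → Lx (E₁ ∷ z ++ [ e ])) (f-prefix-01 pre₁) LE₁ , LE₂
  where
  Lx-reassoc : ∀ {t} → Lx (a ∷ (s ++ morph f z) ++ t) → Lx (a ∷ s ++ morph f z ++ t)
  Lx-reassoc {t} = subst (λ w → Lx (a ∷ w)) (++-assoc s (morph f z) t)

preimage-of-22-extensions : ∀ {a q s z} → q ≡ s ++ morph f z → MarkerFree c0 s →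
                            Lx (a ∷ q ++ c0 ∷ c2 ∷ c0 ∷ []) → Lx (a ∷ q ++ c0 ∷ c2 ∷ c2 ∷ []) →
                            Preimage a s z c2 c1
preimage-of-22-extensions {a} {s = s} {z} refl mf L₀ L₂ =
  let E₁ , e₁ , s₁ , _ , LE₁    = lift-x {z = z ++ [ c2 ]} {t = []} mf [] (subst (λ w → Lx (a ∷ w)) reassoc L₀)
      E₂ , e₂ , s₂ , pre₂ , LE₂ = lift-x {t = c2 ∷ c2 ∷ []} mf ((λ ()) ∷ (λ ()) ∷ [])
                                    (subst (λ w → Lx (a ∷ w)) (++-assoc s (morph f z) _) L₂)
  in E₁ , E₂ , s₁ , s₂ , Factors-prefix (E₁ ∷ z ++ [ c2 ]) [ e₁ ] LE₁ ,
     subst (λ e → Lx (E₂ ∷ z ++ [ e ])) (f-prefix-022 pre₂) LE₂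
  where
  open ≡-Reasoning
  reassoc : (s ++ morph f z) ++ c0 ∷ c2 ∷ c0 ∷ [] ≡ s ++ morph f (z ++ [ c2 ]) ++ [ c0 ]
  reassoc = begin
    (s ++ morph f z) ++ c0 ∷ c2 ∷ c0 ∷ []       ≡⟨ ++-assoc s (morph f z) _ ⟩
    s ++ morph f z ++ c0 ∷ c2 ∷ c0 ∷ []         ≡⟨ cong (s ++_) (sym (++-assoc (morph f z) (c0 ∷ c2 ∷ []) [ c0 ])) ⟩
    s ++ (morph f z ++ c0 ∷ c2 ∷ []) ++ [ c0 ]  ≡⟨ cong (λ X → s ++ X ++ [ c0 ]) (sym (f-code.H-∷ʳ z c2)) ⟩
    s ++ morph f (z ++ [ c2 ]) ++ [ c0 ]        ∎

AmbiguousRSx : Word → Set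
AmbiguousRSx z = ∃[ E ] ∃[ E′ ] (E ≢ E′ × RSx (E ∷ z) × RSx (E′ ∷ z))

AmbiguityWithin : ℕ → Set
AmbiguityWithin n = ∃[ z ] (length z ≤ n × z ≢ [] × AmbiguousRSx z)

-- Two preimages of words with the same last letter share an extension: 0 when that letter
-- is 0, and 1 when it is 2. This excludes the case z = [] when a ∷ s is the ambiguous
-- block suffix 2.
CommonSlot : Σ₃ → Σ₃ → Σ₃ → Σ₃ → Set
CommonSlot e₁ e₂ e₁′ e₂′ = (e₁ ≡ c0 × e₁′ ≡ c0) ⊎ (e₂ ≡ c1 × e₂′ ≡ c1)

CommonSlot-sym : ∀ {e₁ e₂ e₁′ e₂′} → CommonSlot e₁ e₂ e₁′ e₂′ → CommonSlot e₁′ e₂′ e₁ e₂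
CommonSlot-sym (inj₁ (p , q)) = inj₁ (q , p)
CommonSlot-sym (inj₂ (p , q)) = inj₂ (q , p)

preimages-unambiguous : ∀ {a a′ s z e₁ e₂ e₁′ e₂′} → e₁ ≢ e₂ → e₁′ ≢ e₂′ → a ≢ a′ →
                        a ∷ s ≢ [ c2 ] → a′ ∷ s ≢ [ c2 ] →
                        Preimage a s z e₁ e₂ → Preimage a′ s z e₁′ e₂′ → z ≢ [] × AmbiguousRSx z
preimages-unambiguous {z = z} {e₁} {e₂} {e₁′} {e₂′} e₁≢e₂ e₁′≢e₂′ a≢a′ w≢2 w′≢2
                      (E , E₂ , sE , sE₂ , LE , LE₂) (E′ , E₂′ , sE′ , sE₂′ , LE′ , LE₂′)
  with FSuffix-unique sE sE₂ w≢2 | FSuffix-unique sE′ sE₂′ w′≢2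
... | refl | refl = z≢[] , E , E′ , E≢E′ , rs , rs′
  where
  rs : RSx (E ∷ z)
  rs = e₁ , e₂ , e₁≢e₂ , LE , LE₂
  rs′ : RSx (E′ ∷ z)
  rs′ = e₁′ , e₂′ , e₁′≢e₂′ , LE′ , LE₂′
  E≢E′ : E ≢ E′
  E≢E′ refl with FSuffix-first-letter sE sE′ a≢a′ w≢2 w′≢2
  ... | inj₁ (refl , ())
  ... | inj₂ (refl , ())
  z≢[] : z ≢ []
  z≢[] refl with FSuffix-first-letter sE sE′ a≢a′ w≢2 w′≢2
  ... | inj₁ (refl , _) = no-RSx-ending-in-1 [] rs
  ... | inj₂ (_ , refl) = no-RSx-ending-in-1 [] rs′

preimages-ambiguous : ∀ {a′ z e₁ e₂ e₁′ e₂′} → e₁ ≢ e₂ → e₁′ ≢ e₂′ → a′ ≢ c2 → CommonSlot e₁ e₂ e₁′ e₂′ →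
                      Preimage c2 [] z e₁ e₂ → Preimage a′ [] z e₁′ e₂′ → z ≢ [] × AmbiguousRSx z
preimages-ambiguous {z = []} _ _ a′≢2 slot (_ , E₂ , _ , sE₂ , _ , LE₂) (_ , _ , sE₁′ , _ , LE₁′ , _)
  with FSuffix-1 sE₁′ a′≢2 | slot
... | refl | inj₁ (_ , refl) with adjacentˣ-at-start [] LE₁′
...   | ()
preimages-ambiguous {z = []} _ _ a′≢2 slot (_ , E₂ , _ , sE₂ , _ , LE₂) (_ , _ , sE₁′ , _ , LE₁′ , _)
  | refl | inj₂ (refl , _) with adjacentˣ-at-start [] LE₂
...   | p01 = ⊥-elim (FSuffix-2 sE₂ refl)
preimages-ambiguous {z = z₁ ∷ zr} {e₁} {e₂} {e₁′} {e₂′} e₁≢e₂ e₁′≢e₂′ a′≢2 _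
                    (E₁ , E₂ , sE₁ , sE₂ , LE₁ , LE₂) (E₁′ , E₂′ , sE₁′ , sE₂′ , LE₁′ , LE₂′)
  with FSuffix-1 sE₁′ a′≢2 | FSuffix-1 sE₂′ a′≢2
... | refl | refl
  with adjacent-after-0 (adjacentˣ-at-start _ LE₁′) (adjacentˣ-at-start _ LE₁) (FSuffix-2 sE₁)
     | adjacent-after-0 (adjacentˣ-at-start _ LE₁′) (adjacentˣ-at-start _ LE₂) (FSuffix-2 sE₂)
...   | refl | refl = (λ ()) , c2 , c0 , (λ ()) , (e₁ , e₂ , e₁≢e₂ , LE₁ , LE₂) , (e₁′ , e₂′ , e₁′≢e₂′ , LE₁′ , LE₂′)

preimages-disagree : ∀ {a a′ s z e₁ e₂ e₁′ e₂′} → e₁ ≢ e₂ → e₁′ ≢ e₂′ → CommonSlot e₁ e₂ e₁′ e₂′ → a ≢ a′ →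
                     Preimage a s z e₁ e₂ → Preimage a′ s z e₁′ e₂′ → z ≢ [] × AmbiguousRSx z
preimages-disagree {a} {a′} {s} ne ne′ slot a≢a′ pre pre′
  with ≡-dec _≟₃_ (a ∷ s) [ c2 ] | ≡-dec _≟₃_ (a′ ∷ s) [ c2 ]
... | yes refl | _        = preimages-ambiguous ne ne′ (λ a′≡2 → a≢a′ (sym a′≡2)) slot pre pre′
... | no _     | yes refl = preimages-ambiguous ne′ ne a≢a′ (CommonSlot-sym slot) pre′ pre
... | no w≢2   | no w′≢2  = preimages-unambiguous ne ne′ a≢a′ w≢2 w′≢2 pre pre′

descent-at-0 : ∀ {E E′ q} → E ≢ E′ → RSx (E ∷ q ++ [ c0 ]) → RSx (E′ ∷ q ++ [ c0 ]) →
               AmbiguityWithin (length q)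
descent-at-0 {E} {E′} {q} E≢E′ rs rs′ =
  let L₁ , L₂           = RSx-ending-in-0 (E ∷ q) rs
      L₁′ , L₂′         = RSx-ending-in-0 (E′ ∷ q) rs′
      s , z , q≡ , mf   = decompose-x (Factors-suffix [ E ] (q ++ c0 ∷ [ c1 ]) L₁)
      e , 0≢e , pre     = preimage-of-0-extensions q≡ mf L₁ L₂
      e′ , 0≢e′ , pre′  = preimage-of-0-extensions q≡ mf L₁′ L₂′
      z≢[] , amb        = preimages-disagree 0≢e 0≢e′ (inj₁ (refl , refl)) E≢E′ pre pre′
  in z , length-≤-decomposition s z q≡ , z≢[] , amb

descent-at-02 : ∀ {E E′ q b} → b ≡ c0 → E ≢ E′ →
                Lx (E ∷ q ++ b ∷ c2 ∷ c0 ∷ []) → Lx (E ∷ q ++ b ∷ c2 ∷ c2 ∷ []) →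
                Lx (E′ ∷ q ++ b ∷ c2 ∷ c0 ∷ []) → Lx (E′ ∷ q ++ b ∷ c2 ∷ c2 ∷ []) →
                AmbiguityWithin (length q)
descent-at-02 {E} {E′} {q} refl E≢E′ L₀ L₂ L₀′ L₂′ =
  let s , z , q≡ , mf = decompose-x (Factors-suffix [ E ] (q ++ c0 ∷ c2 ∷ [ c2 ]) L₂)
      z≢[] , amb      = preimages-disagree (λ ()) (λ ()) (inj₂ (refl , refl)) E≢E′
                          (preimage-of-22-extensions q≡ mf L₀ L₂) (preimage-of-22-extensions q≡ mf L₀′ L₂′)
  in z , length-≤-decomposition s z q≡ , z≢[] , amb

descent-at-2 : ∀ {E E′ q} → E ≢ E′ → RSx (E ∷ q ++ [ c2 ]) → RSx (E′ ∷ q ++ [ c2 ]) →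
               AmbiguityWithin (length q)
descent-at-2 {E} {E′} {q} E≢E′ rs rs′ with reverseView q
... | [] =
  let _ , L₂  = RSx-ending-in-2 [ E ] rs
      _ , L₂′ = RSx-ending-in-2 [ E′ ] rs′
  in ⊥-elim (E≢E′ (trans (before-22 [] L₂) (sym (before-22 [] L₂′))))
... | q₁ ∶ _ ∶ʳ b =
  let L₀ , L₂                   = RSx-ending-in-2 (E ∷ q₁ ++ [ b ]) rs
      L₀′ , L₂′                 = RSx-ending-in-2 (E′ ∷ q₁ ++ [ b ]) rs′
      z , |z|≤|q₁| , z≢[] , amb = descent-at-02 {q = q₁} (before-22 (E ∷ q₁) (Lx-∷-∷ʳ-++ L₂)) E≢E′
                                    (Lx-∷-∷ʳ-++ L₀) (Lx-∷-∷ʳ-++ L₂) (Lx-∷-∷ʳ-++ L₀′) (Lx-∷-∷ʳ-++ L₂′)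
  in z , ≤-trans |z|≤|q₁| (length-++-≤ˡ q₁) , z≢[] , amb

descent-at : ∀ l {E E′ q} → E ≢ E′ → RSx (E ∷ q ++ [ l ]) → RSx (E′ ∷ q ++ [ l ]) →
             AmbiguityWithin (length q)
descent-at c0               = descent-at-0
descent-at c1 {E} {q = q} _ rs _ = ⊥-elim (no-RSx-ending-in-1 (E ∷ q) rs)
descent-at c2               = descent-at-2

AmbiguousRSx-descent : ∀ w → w ≢ [] → AmbiguousRSx w →
                       ∃[ z ] (length z < length w × z ≢ [] × AmbiguousRSx z)
AmbiguousRSx-descent w w≢[] amb with reverseView w
... | [] = ⊥-elim (w≢[] refl)
... | q ∶ _ ∶ʳ l with amb
...   | E , E′ , E≢E′ , rs , rs′ with descent-at l E≢E′ rs rs′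
...   | z , |z|≤|q| , z≢[] , amb′ = z , ≤-trans (s≤s |z|≤|q|) (length-++-∷ q l []) , z≢[] , amb′

no-AmbiguousRSx : ∀ w → w ≢ [] → ¬ AmbiguousRSx w
no-AmbiguousRSx = WF.All.wfRec (On.wellFounded length <-wellFounded) _ (λ w → w ≢ [] → ¬ AmbiguousRSx w) step
  where
  step : ∀ w → (∀ {z} → length z < length w → z ≢ [] → ¬ AmbiguousRSx z) → w ≢ [] → ¬ AmbiguousRSx w
  step w IH w≢[] amb with AmbiguousRSx-descent w w≢[] amb
  ... | z , |z|<|w| , z≢[] , amb′ = IH |z|<|w| z≢[] amb′

RSx-determined-by-last-letter : ∀ p p′ {l} → length p ≡ length p′ →
                                RSx (p ++ [ l ]) → RSx (p′ ++ [ l ]) → p ≡ p′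
RSx-determined-by-last-letter []      []        _   _  _   = refl
RSx-determined-by-last-letter (a ∷ q) (a′ ∷ q′) {l} len rs rs′
  with RSx-determined-by-last-letter q q′ (suc-injective len)
         (RightSpecial-suffix [ a ] (q ++ [ l ]) rs) (RightSpecial-suffix [ a′ ] (q′ ++ [ l ]) rs′)
... | refl with a ≟₃ a′
...   | yes refl = refl
...   | no a≢a′  = ⊥-elim (no-AmbiguousRSx (q ++ [ l ]) (λ eq → []≢++∷ q (sym eq)) (a , a′ , a≢a′ , rs , rs′))

RSx-suffix-of-family : ∀ (W : ℕ → Word) l → (∀ k → k < length (W k)) → (∀ k → EndsWith (W k) [ l ]) →
                       (∀ k → RSx (W k)) → ∀ p → RSx (p ++ [ l ]) → EndsWith (W (length p)) (p ++ [ l ])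
RSx-suffix-of-family W l W-long W-ends W-RS p rs
  with suffix-of-length (W (length p)) (suc (length p)) (W-long (length p))
... | t , (P , W≡P++t) , |t|≡ with suffix-of-suffix (W-ends (length p)) (P , W≡P++t) (subst (1 ≤_) (sym |t|≡) (s≤s z≤n))
...   | t₀ , refl
  with RSx-determined-by-last-letter t₀ p (suc-injective (trans (sym (length-∷ʳ t₀ l)) |t|≡))
         (RightSpecial-suffix P (t₀ ++ [ l ]) (subst RSx W≡P++t (W-RS (length p)))) rs
...   | refl = P , W≡P++t

RSx-suffix-of-α-or-β : ∀ z → z ≢ [] → RSx z → (∃[ K ] EndsWith (α K) z) ⊎ (∃[ K ] EndsWith (β K) z)
RSx-suffix-of-α-or-β z z≢[] rs with reverseView z
... | [] = ⊥-elim (z≢[] refl)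
... | p ∶ _ ∶ʳ c0 = inj₁ (length p , RSx-suffix-of-family α c0 α-long α-ends-with-0 α-RSx p rs)
... | p ∶ _ ∶ʳ c1 = ⊥-elim (no-RSx-ending-in-1 p rs)
... | p ∶ _ ∶ʳ c2 = inj₂ (length p , RSx-suffix-of-family β c2 β-long β-ends-with-2 β-RSx p rs)

-- Right special factors of y

g-suffix : ∀ {E σ s} → MarkerFree c2 (σ ∷ s) → EndsWith (g E) (σ ∷ s) → s ≡ [] × σ ≡ E
g-suffix {c0} (2≢2 ∷ _) ([]    , refl) = ⊥-elim (2≢2 refl)
g-suffix {c1} (2≢2 ∷ _) ([]    , refl) = ⊥-elim (2≢2 refl)
g-suffix {c2} (2≢2 ∷ _) ([]    , refl) = ⊥-elim (2≢2 refl)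
g-suffix {c0} _ (_ ∷ []        , refl) = refl , refl
g-suffix {c1} _ (_ ∷ []        , refl) = refl , refl
g-suffix {c2} _ (_ ∷ []        , ())
g-suffix {c0} _ (_ ∷ _ ∷ []    , ())
g-suffix {c0} _ (_ ∷ _ ∷ _ ∷ _ , ())
g-suffix {c1} _ (_ ∷ _ ∷ []    , ())
g-suffix {c1} _ (_ ∷ _ ∷ _ ∷ _ , ())
g-suffix {c2} _ (_ ∷ _ ∷ _     , ())

g-prefix : ∀ {e c} → StartsWith (g e) (c2 ∷ [ c ]) → e ≡ c
g-prefix {c0} (_ , refl) = refl
g-prefix {c1} (_ , refl) = refl

lift-y-aligned : ∀ z c → Ly (morph g z ++ c2 ∷ [ c ]) → Lx (z ++ [ c ])
lift-y-aligned z c (k , occ) with c ≟₃ c2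
... | no c≢2 =
  let e′ , occ′ , pre = g-code.lift-aligned-occurrence {U = fᵏ0 k} z (c≢2 ∷ []) occ
  in subst (λ e → Lx (z ++ [ e ])) (g-prefix pre) (k , occ′)
-- No block of g begins with 22, so the first 2 is the whole block g(2).
lift-y-aligned z c (k , occ) | yes refl =
  let e′ , occ′ , _ = g-code.lift-aligned-occurrence {U = fᵏ0 k} (z ++ [ c2 ]) {t = []} []
                        (subst (λ w → Infix w (morph g (fᵏ0 k))) g⋆z22≡ occ)
  in Factors-prefix (z ++ [ c2 ]) [ e′ ] (k , occ′)
  where
  g⋆z22≡ : morph g z ++ c2 ∷ [ c2 ] ≡ morph g (z ++ [ c2 ]) ++ [ c2 ]
  g⋆z22≡ = trans (sym (++-assoc (morph g z) [ c2 ] [ c2 ])) (cong (_++ [ c2 ]) (sym (g-code.H-∷ʳ z c2)))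

extend-y : ∀ {σ s z c} → MarkerFree c2 (σ ∷ s) → Ly (σ ∷ s ++ morph g z ++ c2 ∷ [ c ]) →
           s ≡ [] × Ly (morph g (σ ∷ z) ++ c2 ∷ [ c ])
extend-y {σ} {z = z} {c} mf@(_ ∷ mfs) (k , occ) =
  let E , suf , occ′ = g-code.extend-to-block-start {U = fᵏ0 k} {z = z} mfs occ
      s≡[] , σ≡E     = g-suffix mf suf
  in s≡[] , subst (λ e → Ly (morph g (e ∷ z) ++ c2 ∷ [ c ])) (sym σ≡E) (k , occ′)

g-ends-with-letter : ∀ {σ} z → σ ≢ c2 → EndsWith (morph g (σ ∷ z)) (σ ∷ morph g z)
g-ends-with-letter {c0} z _ = [ c2 ] , refl
g-ends-with-letter {c1} z _ = [ c2 ] , refl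
g-ends-with-letter {c2} z σ≢2 = ⊥-elim (σ≢2 refl)

RSy : Word → Set
RSy = RightSpecialIn Ly

decompose-y : ∀ {v t} → Ly (v ++ c2 ∷ t) → ∃[ s ] ∃[ z ] (v ≡ s ++ morph g z × MarkerFree c2 s)
decompose-y (k , occ) = g-code.decompose-before-marker {U = fᵏ0 k} occ

RSy-extensions : ∀ p {l} → RSy (p ++ [ l ]) →
                 ∃[ c ] ∃[ d ] (c ≢ d × Ly (p ++ l ∷ c ∷ []) × Ly (p ++ l ∷ d ∷ []))
RSy-extensions p {l} (c , d , c≢d , Lc , Ld) =
  c , d , c≢d , subst Ly (++-assoc p [ l ] [ c ]) Lc , subst Ly (++-assoc p [ l ] [ d ]) Ld

RSy-ends-with-2 : ∀ p {l} → RSy (p ++ [ l ]) → l ≡ c2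
RSy-ends-with-2 p rs with RSy-extensions p rs
... | c , d , c≢d , Lc , Ld with adjacentʸ-at-end p Lc | adjacentʸ-at-end p Ld
... | p2∗ | _   = refl
... | p02 | p02 = ⊥-elim (c≢d refl)
... | p12 | p12 = ⊥-elim (c≢d refl)

RSy-lift : ∀ {s z c d} → MarkerFree c2 s → c ≢ d →
           Ly (s ++ morph g z ++ c2 ∷ [ c ]) → Ly (s ++ morph g z ++ c2 ∷ [ d ]) →
           ∃[ z′ ] (RSx z′ × EndsWith (morph g z′) (s ++ morph g z))
RSy-lift {[]} {z} {c} {d} _ c≢d Lc Ld =
  z , (c , d , c≢d , lift-y-aligned z c Lc , lift-y-aligned z d Ld) , [] , refl
RSy-lift {σ ∷ s} {z} {c} {d} mf@(σ≢2 ∷ _) c≢d Lc Ld with extend-y {z = z} mf Lc | extend-y {z = z} mf Ld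
... | refl , Lc′ | _ , Ld′ =
  σ ∷ z , (c , d , c≢d , lift-y-aligned (σ ∷ z) c Lc′ , lift-y-aligned (σ ∷ z) d Ld′) , g-ends-with-letter z σ≢2

-- The words u and v of the theorem are the suffixes of length n of αʸ n and βʸ n.
αʸ : ℕ → Word
αʸ K = morph g (α K) ++ [ c2 ]

βʸ : ℕ → Word
βʸ K = morph g (β K) ++ [ c2 ]

g-image-suffix : ∀ {w₀ z′ W} → EndsWith (morph g z′) w₀ → EndsWith W z′ →
                 EndsWith (morph g W ++ [ c2 ]) (w₀ ++ [ c2 ])
g-image-suffix suf suf′ = suffix-++ [ c2 ] (suffix-trans suf (EndsWith-morph g suf′))

RSy-ending-in-2 : ∀ w₀ → w₀ ≢ [] → RSy (w₀ ++ [ c2 ]) →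
                  (∃[ K ] EndsWith (αʸ K) (w₀ ++ [ c2 ])) ⊎ (∃[ K ] EndsWith (βʸ K) (w₀ ++ [ c2 ]))
RSy-ending-in-2 w₀ w₀≢[] rs =
  let c , d , c≢d , Lc , Ld = RSy-extensions w₀ rs
      s , z , w₀≡ , mf      = decompose-y Lc
      z′ , rs′ , suf        = RSy-lift {s} {z} mf c≢d (reassoc {s} {z} w₀≡ Lc) (reassoc {s} {z} w₀≡ Ld)
      suf₀                  = subst (EndsWith (morph g z′)) (sym w₀≡) suf
      z′≢[]                 = λ z′≡[] → w₀≢[] (suffix-of-[] (subst (λ x → EndsWith (morph g x) w₀) z′≡[] suf₀))
  in Sum.map (map₂ (g-image-suffix suf₀)) (map₂ (g-image-suffix suf₀)) (RSx-suffix-of-α-or-β z′ z′≢[] rs′)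
  where
  reassoc : ∀ {s z c} → w₀ ≡ s ++ morph g z → Ly (w₀ ++ c2 ∷ [ c ]) → Ly (s ++ morph g z ++ c2 ∷ [ c ])
  reassoc {s} {z} w₀≡ = subst Ly (trans (cong (_++ _) w₀≡) (++-assoc s (morph g z) _))

RSy-suffix-of-family : ∀ w → 2 ≤ length w → RSy w → (∃[ K ] EndsWith (αʸ K) w) ⊎ (∃[ K ] EndsWith (βʸ K) w)
RSy-suffix-of-family w 2≤|w| rs with reverseView w
... | [] with 2≤|w|
...   | ()
RSy-suffix-of-family w 2≤|w| rs | w₀ ∶ _ ∶ʳ l with RSy-ends-with-2 w₀ rs
... | refl = RSy-ending-in-2 w₀ (init-nonempty w₀ 2≤|w|) rs

-- Positions in the infinite words

nth-++ˡ : ∀ (A B : Word) {i} d → i < length A → nth (A ++ B) i d ≡ nth A i d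
nth-++ˡ (a ∷ A) B {zero}  d _         = refl
nth-++ˡ (a ∷ A) B {suc i} d (s≤s i<n) = nth-++ˡ A B d i<n

nth-++ʳ : ∀ (P X : Word) j d → nth (P ++ X) (length P + j) d ≡ nth X j d
nth-++ʳ []      X j d = refl
nth-++ʳ (x ∷ P) X j d = nth-++ʳ P X j d

nth-drop : ∀ i (L : Word) j d → nth (drop i L) j d ≡ nth L (i + j) d
nth-drop zero    L       j d = refl
nth-drop (suc i) []      j d = refl
nth-drop (suc i) (x ∷ L) j d = nth-drop i L j d

length-drop-≥ : ∀ i (L : Word) n → i + n ≤ length L → n ≤ length (drop i L)
length-drop-≥ zero    L       n le       = le
length-drop-≥ (suc i) (x ∷ L) n (s≤s le) = length-drop-≥ i L n le

length-prefix : ∀ (x : InfWord) n → length (prefix x n) ≡ n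
length-prefix x zero    = refl
length-prefix x (suc n) = cong suc (length-prefix (λ i → x (suc i)) n)

prefix≡take : ∀ (x : InfWord) (L : Word) n → n ≤ length L → (∀ j → j < n → x j ≡ nth L j c0) →
              prefix x n ≡ take n L
prefix≡take x L       zero    _          _     = refl
prefix≡take x (l ∷ L) (suc n) (s≤s n≤|L|) agree =
  cong₂ _∷_ (agree 0 (s≤s z≤n)) (prefix≡take (λ i → x (suc i)) L n n≤|L| (λ j j<n → agree (suc j) (s≤s j<n)))

fᵏ0-extends : ∀ k j → ∃[ T ] (fᵏ0 (j + k) ≡ fᵏ0 k ++ T)
fᵏ0-extends k zero    = [] , sym (++-identityʳ (fᵏ0 k))
fᵏ0-extends k (suc j) with fᵏ0-extends k j | fᵏ0-grows (j + k)
... | T , eq | t , T′ , eq′ = T ++ t ∷ T′ , trans eq′ (trans (cong (_++ t ∷ T′) eq) (++-assoc (fᵏ0 k) T (t ∷ T′)))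

fᵏ0-monotone : ∀ {k k′} → k ≤ k′ → ∃[ T ] (fᵏ0 k′ ≡ fᵏ0 k ++ T)
fᵏ0-monotone {k} {k′} k≤k′ = subst (λ m → ∃[ T ] (fᵏ0 m ≡ fᵏ0 k ++ T)) (m∸n+n≡m k≤k′) (fᵏ0-extends k (k′ ∸ k))

fᵏ0-long : ∀ k → k < length (fᵏ0 k)
fᵏ0-long zero    = s≤s z≤n
fᵏ0-long (suc k) with fᵏ0-grows k
... | t , T , eq = subst (λ L → suc k < length L) (sym eq) (≤-trans (s≤s (fᵏ0-long k)) (length-++-∷ (fᵏ0 k) t T))

fω0-agrees : ∀ k i → i < length (fᵏ0 k) → fω0 i ≡ nth (fᵏ0 k) i c0
fω0-agrees k i i<n with ≤-total k (suc i)
... | inj₁ k≤1+i =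
  let T , eq = fᵏ0-monotone k≤1+i in trans (cong (λ L → nth L i c0) eq) (nth-++ˡ (fᵏ0 k) T c0 i<n)
... | inj₂ 1+i≤k =
  let T , eq = fᵏ0-monotone 1+i≤k in
  sym (trans (cong (λ L → nth L i c0) eq) (nth-++ˡ (fᵏ0 (suc i)) T c0 (≤-trans (n≤1+n _) (fᵏ0-long (suc i)))))

y-agrees : ∀ k i → i < length (fᵏ0 k) → y i ≡ nth (morph g (fᵏ0 k)) i c0
y-agrees k i i<n = begin
  nth (morph g (prefix fω0 (suc i))) i c0      ≡⟨ cong (λ L → nth (morph g L) i c0) x-prefix≡ ⟩
  nth (morph g (take (suc i) (fᵏ0 k))) i c0     ≡⟨ sym (nth-++ˡ (morph g (take (suc i) (fᵏ0 k))) _ c0 i<|g⋆take|) ⟩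
  nth (morph g (take (suc i) (fᵏ0 k)) ++ morph g (drop (suc i) (fᵏ0 k))) i c0
                                               ≡⟨ cong (λ L → nth L i c0) (sym (g-code.H-++ (take (suc i) (fᵏ0 k)) _)) ⟩
  nth (morph g (take (suc i) (fᵏ0 k) ++ drop (suc i) (fᵏ0 k))) i c0
                                               ≡⟨ cong (λ L → nth (morph g L) i c0) (take++drop≡id (suc i) (fᵏ0 k)) ⟩
  nth (morph g (fᵏ0 k)) i c0                   ∎
  where
  open ≡-Reasoning
  x-prefix≡ : prefix fω0 (suc i) ≡ take (suc i) (fᵏ0 k)
  x-prefix≡ = prefix≡take fω0 (fᵏ0 k) (suc i) i<n (λ j j<1+i → fω0-agrees k j (≤-trans j<1+i i<n))
  i<|g⋆take| : i < length (morph g (take (suc i) (fᵏ0 k)))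
  i<|g⋆take| = ≤-trans (≤-reflexive (trans (sym (length-prefix fω0 (suc i))) (cong length x-prefix≡)))
                       (g-code.length-H (take (suc i) (fᵏ0 k)))

Factor-y⇒Ly : ∀ {w} → Factor y w → Ly w
Factor-y⇒Ly {w} (i , slice≡w) = K , take i Y , drop n L , Y≡
  where
  n = length w
  K = i + n
  Y = morph g (fᵏ0 K)
  L = drop i Y
  K<|fK| : K < length (fᵏ0 K)
  K<|fK| = fᵏ0-long K
  slice≡take : slice y i n ≡ take n L
  slice≡take = prefix≡take (λ j → y (i + j)) L n
    (length-drop-≥ i Y n (≤-trans (<⇒≤ K<|fK|) (g-code.length-H (fᵏ0 K))))
    (λ j j<n → trans (y-agrees K (i + j) (≤-trans (+-monoʳ-< i j<n) (<⇒≤ K<|fK|))) (sym (nth-drop i Y j c0)))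
  Y≡ : Y ≡ take i Y ++ w ++ drop n L
  Y≡ = trans (sym (take++drop≡id i Y))
         (cong (take i Y ++_) (trans (sym (take++drop≡id n L)) (cong (_++ drop n L) (trans (sym slice≡take) slice≡w))))

Ly⇒Factor-y : ∀ {w} → Ly w → Factor y w
Ly⇒Factor-y {w} (k , P , Q , eq) = length P , trans slice≡take (take-all (length w) w ≤-refl)
  where
  K = (length P + length w) + k
  T = proj₁ (fᵏ0-extends k (length P + length w))
  Y≡ : morph g (fᵏ0 K) ≡ P ++ w ++ Q ++ morph g T
  Y≡ = begin
    morph g (fᵏ0 K)                   ≡⟨ cong (morph g) (proj₂ (fᵏ0-extends k (length P + length w))) ⟩
    morph g (fᵏ0 k ++ T)              ≡⟨ g-code.H-++ (fᵏ0 k) T ⟩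
    morph g (fᵏ0 k) ++ morph g T      ≡⟨ cong (_++ morph g T) eq ⟩
    (P ++ w ++ Q) ++ morph g T        ≡⟨ solve (++-monoid Σ₃) ⟩
    P ++ w ++ Q ++ morph g T          ∎
    where open ≡-Reasoning
  slice≡take : slice y (length P) (length w) ≡ take (length w) w
  slice≡take = prefix≡take (λ j → y (length P + j)) w (length w) ≤-refl λ j j<|w| → begin
    y (length P + j)                                  ≡⟨ y-agrees K (length P + j) (bound j<|w|) ⟩
    nth (morph g (fᵏ0 K)) (length P + j) c0           ≡⟨ cong (λ L → nth L (length P + j) c0) Y≡ ⟩
    nth (P ++ w ++ Q ++ morph g T) (length P + j) c0  ≡⟨ nth-++ʳ P (w ++ Q ++ morph g T) j c0 ⟩
    nth (w ++ Q ++ morph g T) j c0                    ≡⟨ nth-++ˡ w (Q ++ morph g T) c0 j<|w| ⟩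
    nth w j c0                                        ∎
    where
    open ≡-Reasoning
    bound : ∀ {j} → j < length w → length P + j < length (fᵏ0 K)
    bound j<|w| = ≤-trans (+-monoʳ-< (length P) j<|w|)
                          (≤-trans (m≤m+n (length P + length w) k) (<⇒≤ (fᵏ0-long K)))

RightSpecial-y⇒RSy : ∀ {w} → RightSpecial y w → RSy w
RightSpecial-y⇒RSy (a , b , a≢b , Fa , Fb) = a , b , a≢b , Factor-y⇒Ly Fa , Factor-y⇒Ly Fb

αʸ-suffix-of-next : ∀ k → EndsWith (αʸ (suc k)) (αʸ k)
αʸ-suffix-of-next k = suffix-++ [ c2 ] (EndsWith-morph g (α-suffix-of-next k))

βʸ-suffix-of-next : ∀ k → EndsWith (βʸ (suc k)) (βʸ k)
βʸ-suffix-of-next k = suffix-++ [ c2 ] (EndsWith-morph g (β-suffix-of-next k))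

g-image-long : ∀ W n → n < length W → n ≤ length (morph g W ++ [ c2 ])
g-image-long W n n<|W| = ≤-trans (<⇒≤ n<|W|) (≤-trans (g-code.length-H W) (length-++-≤ˡ (morph g W)))

αʸ-ends-with-02 : ∀ n → EndsWith (αʸ n) (c0 ∷ c2 ∷ [])
αʸ-ends-with-02 n = suffix-trans ([ c2 ] , refl) (suffix-++ [ c2 ] (EndsWith-morph g (α-ends-with-0 n)))

βʸ-ends-with-22 : ∀ n → EndsWith (βʸ n) (c2 ∷ c2 ∷ [])
βʸ-ends-with-22 n = suffix-++ [ c2 ] (EndsWith-morph g (β-ends-with-2 n))

Ly-g-extension : ∀ W c → Lx (W ++ [ c ]) → Ly (morph g W ++ c2 ∷ [ c ])
Ly-g-extension W c0 L = subst Ly (g-code.H-∷ʳ W c0) (Lx⇒Ly L)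
Ly-g-extension W c1 L = subst Ly (g-code.H-∷ʳ W c1) (Lx⇒Ly L)
Ly-g-extension W c2 L =
  let c , L′ = Lx-extendʳ L
  in Factors-prefix (morph g W ++ c2 ∷ [ c2 ]) (g-body c) (subst Ly (g⋆W2c≡ c) (Lx⇒Ly L′))
  where
  open ≡-Reasoning
  g⋆W2c≡ : ∀ c → morph g ((W ++ [ c2 ]) ++ [ c ]) ≡ (morph g W ++ c2 ∷ [ c2 ]) ++ g-body c
  g⋆W2c≡ c = begin
    morph g ((W ++ [ c2 ]) ++ [ c ])          ≡⟨ g-code.H-∷ʳ (W ++ [ c2 ]) c ⟩
    morph g (W ++ [ c2 ]) ++ g c              ≡⟨ cong₂ _++_ (g-code.H-∷ʳ W c2) (g≡2∷g-body c) ⟩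
    (morph g W ++ [ c2 ]) ++ c2 ∷ g-body c    ≡⟨ solve (++-monoid Σ₃) ⟩
    (morph g W ++ c2 ∷ [ c2 ]) ++ g-body c    ∎

Ly-suffix-extension : ∀ W {u c} → EndsWith (morph g W ++ [ c2 ]) u → Ly (morph g W ++ c2 ∷ [ c ]) → Ly (u ++ [ c ])
Ly-suffix-extension W {c = c} suf L =
  Factors-infix (suffix⇒infix (suffix-++ [ c ] suf)) (subst Ly (sym (++-assoc (morph g W) [ c2 ] [ c ])) L)

proposition23 : (n : ℕ) → 2 ≤ n →
    ∃[ u ] ∃[ v ]
      ( length u ≡ n × length v ≡ n
      × EndsWith u (c0 ∷ c2 ∷ [])
      × Factor y (u ++ c1 ∷ []) × Factor y (u ++ c2 ∷ [])
      × EndsWith v (c2 ∷ c2 ∷ [])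
      × Factor y (v ++ c0 ∷ []) × Factor y (v ++ c2 ∷ [])
      × ((w : Word) → length w ≡ n → RightSpecial y w → (w ≡ u ⊎ w ≡ v)) )
proposition23 n 2≤n =
  let u , u-suf , |u|≡n = suffix-of-length (αʸ n) n (g-image-long (α n) n (α-long n))
      v , v-suf , |v|≡n = suffix-of-length (βʸ n) n (g-image-long (β n) n (β-long n))
  in u , v , |u|≡n , |v|≡n
   , suffix-of-suffix (αʸ-ends-with-02 n) u-suf (long u |u|≡n)
   , Ly⇒Factor-y (Ly-suffix-extension (α n) u-suf (Ly-g-extension (α n) c1 (α-1 n)))
   , Ly⇒Factor-y (Ly-suffix-extension (α n) u-suf (Ly-g-extension (α n) c2 (α-2 n)))
   , suffix-of-suffix (βʸ-ends-with-22 n) v-suf (long v |v|≡n)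
   , Ly⇒Factor-y (Ly-suffix-extension (β n) v-suf (Ly-g-extension (β n) c0 (β-0 n)))
   , Ly⇒Factor-y (Ly-suffix-extension (β n) v-suf (Ly-g-extension (β n) c2 (β-2 n)))
   , λ w |w|≡n rs →
       Sum.map (λ occ → suffix-of-chain-unique αʸ αʸ-suffix-of-next {n} occ u-suf (trans |w|≡n (sym |u|≡n)))
               (λ occ → suffix-of-chain-unique βʸ βʸ-suffix-of-next {n} occ v-suf (trans |w|≡n (sym |v|≡n)))
               (RSy-suffix-of-family w (long w |w|≡n) (RightSpecial-y⇒RSy rs))
  where
  long : ∀ (w : Word) → length w ≡ n → 2 ≤ length w
  long w |w|≡n = subst (2 ≤_) (sym |w|≡n) 2≤n
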